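{- Let $k\ge 4$ be even and let $G$ be a simple graph possibly with loops. Let $u$ and $\bar u$ be two vertices lying in the same half edge $\mathbf{u}$ of $G^{k,\frac{k}{2}}$. If $\mathbf{x}$ is an eigenvector of the Laplacian tensor $\mathcal{L}(G^{k,\frac{k}{2}})$ corresponding to an eigenvalue $\lambda\neq d_{\mathbf{u}}$, then $\mathbf{x}_u^k=\mathbf{x}_{\bar u}^k$.
   Context: Tensors: a real tensor $\mathcal{T}=(t_{i_1\dots i_k})$ of order $k$ and dimension $n$ has entries indexed by $i_1,\dots,i_k\in[n]$. For $x\in\mathbb{C}^n$, $\mathcal{T}x^{k-1}\in\mathbb{C}^n$ has $i$-th entry $\sum_{i_2,\dots,i_k\in[n]}t_{ii_2\dots i_k}x_{i_2}\cdots x_{i_k}$. A number $\lambda\in\mathbb{C}$ is an eigenvalue of $\mathcal{T}$ with eigenvector $x\in\mathbb{C}^n\setminus\{0\}$ if $\mathcal{T}x^{k-1}=\lambda x^{[k-1]}$, where $x^{[k-1]}=(x_1^{k-1},\dots,x_n^{k-1})$. Hypergraphs: a $k$-uniform hypergraph has all edges of size $k$; a hypergraph with loops is obtained from a $k$-uniform hypergraph by adding edges (loops) of size less than $k$. The degree $d_v$ of a vertex $v$ is the number of edges (loops included) containing $v$. For such a hypergraph on vertices $v_1,\dots,v_n$, the adjacency tensor $\mathcal{A}$ is the order-$k$, dimension-$n$ tensor with $a_{i_1\dots i_k}=\frac{1}{(k-1)!}$ if $\{v_{i_1},\dots,v_{i_k}\}$ is an edge of size $k$ and $0$ otherwise;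 $\mathcal{D}$ is the diagonal tensor with $d_{i\dots i}=d_{v_i}$; the Laplacian tensor is $\mathcal{L}=\mathcal{D}-\mathcal{A}$. Generalized power: for a simple graph $G$ possibly with loops (a loop is an edge with one vertex) and even $k\ge4$, $G^{k,\frac{k}{2}}$ is obtained by replacing each vertex $v$ of $G$ by a set $\mathbf{v}$ of $\frac{k}{2}$ vertices containing $v$ (these sets pairwise disjoint), called a half edge; for each edge $\{u,v\}$ of $G$, $\mathbf{u}\cup\mathbf{v}$ is an edge of $G^{k,\frac{k}{2}}$, and for each loop $\{u\}$ of $G$, $\mathbf{u}$ is a loop of $G^{k,\frac{k}{2}}$. All vertices of $\mathbf{u}$ have the same degree, denoted $d_{\mathbf{u}}$ (equal to the degree of $u$ in $G$, loops counted once). -}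

module Defs where

open import Level using (Level; _⊔_) renaming (suc to lsuc)
open import Algebra.Bundles using (CommutativeRing)
open import Data.Nat as ℕ using (ℕ; zero; suc; _≡ᵇ_; _∸_)
open import Data.Nat using (_!)
open import Data.Nat.Properties using (_!≢0)
open import Data.Fin as Fin using (Fin; zero; suc; _<?_; quotient)
open import Data.Fin.Subset using (Subset; _∪_; ∣_∣)
open import Data.Fin.Subset.Properties using (_∈?_)
open import Data.Vec as Vec using (tabulate)
open import Data.Vec.Properties using (≡-dec)
import Data.Vec.Functional as VF
open import Data.Bool as Bool using (Bool; true; false; _∧_; if_then_else_)
open import Data.Bool.ListAction using (any; all)
open import Data.List as List using (List; []; _∷_; allFin; concatMap; filter; length; _++_; map)
open import Data.Product using (∃; proj₁; _×_)
open import Relation.Nullary using (¬_; ⌊_⌋)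
open import Relation.Binary.PropositionalEquality using (_≡_)

-- Scalars: a field of characteristic zero (ℂ is the paper's instance).

module RingOps {c ℓ} (R : CommutativeRing c ℓ) where
  open CommutativeRing R hiding (zero)

  fromℕ : ℕ → Carrier
  fromℕ zero    = 0#
  fromℕ (suc n) = 1# + fromℕ n

  _^_ : Carrier → ℕ → Carrier
  x ^ zero  = 1#
  x ^ suc n = x * (x ^ n)

record CharZeroField c ℓ : Set (lsuc (c ⊔ ℓ)) where
  field
    commutativeRing : CommutativeRing c ℓ
  open CommutativeRing commutativeRing hiding (zero)
  open RingOps commutativeRing
  field
    1≉0      : ¬ (1# ≈ 0#)
    inverse  : ∀ x → ¬ (x ≈ 0#) → ∃ λ y → x * y ≈ 1#
    charZero : ∀ n → ¬ (fromℕ (suc n) ≈ 0#)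

record Hypergraph (n : ℕ) : Set where
  field
    edges : List (Subset n)

degree : ∀ {n} → Hypergraph n → Fin n → ℕ
degree H v = length (filter (v ∈?_) (Hypergraph.edges H))

image : ∀ {k n} → (Fin k → Fin n) → Subset n
image {k} ι = tabulate (λ v → any (λ j → ⌊ ι j Fin.≟ v ⌋) (allFin k))

isSizeKEdge : ∀ {n} (k : ℕ) → Hypergraph n → (Fin k → Fin n) → Bool
isSizeKEdge k H ι =
  any (λ e → (∣ e ∣ ≡ᵇ k) ∧ ⌊ ≡-dec Bool._≟_ (image ι) e ⌋) (Hypergraph.edges H)

module TensorDefs {c ℓ} (F : CharZeroField c ℓ) where
  open CharZeroField F
  open CommutativeRing commutativeRing public hiding (zero)
  open RingOps commutativeRing public

  Tensor : ℕ → ℕ → Set c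
  Tensor k n = (Fin k → Fin n) → Carrier

  sumFin : ∀ n → (Fin n → Carrier) → Carrier
  sumFin zero    f = 0#
  sumFin (suc n) f = f zero + sumFin n (λ i → f (suc i))

  prodFin : ∀ n → (Fin n → Carrier) → Carrier
  prodFin zero    f = 1#
  prodFin (suc n) f = f zero * prodFin n (λ i → f (suc i))

  sumTuples : ∀ p {n} → ((Fin p → Fin n) → Carrier) → Carrier
  sumTuples zero    f = f (λ ())
  sumTuples (suc p) {n} f = sumFin n (λ i → sumTuples p (λ ι → f (i VF.∷ ι)))

  apply : ∀ {k n} → Tensor k n → (Fin n → Carrier) → Fin n → Carrier
  apply {zero}  T x i = 0#   -- order-0 tensors are never used
  apply {suc p} T x i =
    sumTuples p (λ ι → T (i VF.∷ ι) * prodFin p (λ j → x (ι j)))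

  IsEigenpair : ∀ {k n} → Tensor k n → Carrier → (Fin n → Carrier) → Set ℓ
  IsEigenpair {k} {n} T λ′ x =
    ¬ (∀ i → x i ≈ 0#) × (∀ i → apply T x i ≈ λ′ * (x i ^ (k ∸ 1)))

  private
    nonzero⇒≉0 : ∀ m → ℕ.NonZero m → ¬ (fromℕ m ≈ 0#)
    nonzero⇒≉0 (suc m) _ = charZero m

  -- 1/(k-1)!  (exists since F has characteristic zero)
  invFact : ℕ → Carrier
  invFact k = proj₁ (inverse (fromℕ ((k ∸ 1) !)) (nonzero⇒≉0 _ ((k ∸ 1) !≢0)))

  adjacencyTensor : ∀ k {n} → Hypergraph n → Tensor k n
  adjacencyTensor k H ι = if isSizeKEdge k H ι then invFact k else 0#

  diagonalTensor : ∀ k {n} → (Fin n → Carrier) → Tensor k n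
  diagonalTensor zero    d ι = 0#
  diagonalTensor (suc p) d ι =
    if all (λ j → ⌊ ι j Fin.≟ ι zero ⌋) (allFin (suc p)) then d (ι zero) else 0#

  degreeTensor : ∀ k {n} → Hypergraph n → Tensor k n
  degreeTensor k H = diagonalTensor k (λ v → fromℕ (degree H v))

  laplacianTensor : ∀ k {n} → Hypergraph n → Tensor k n
  laplacianTensor k H ι = degreeTensor k H ι - adjacencyTensor k H ι

record Graph (m : ℕ) : Set where
  field
    adj    : Fin m → Fin m → Bool
    sym    : ∀ u v → adj u v ≡ adj v u
    irrefl : ∀ v → adj v v ≡ false
    loop   : Fin m → Bool

-- Generalized power G^{k,k/2} with k = 2h.  Its vertex set is
-- Fin (m * h) ≅ Fin m × Fin h; the half edge of v ∈ G is
-- {combine v j | j : Fin h}, i.e. the vertices w with quotient h w = v.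
halfEdge : ∀ {m} h → Fin m → Subset (m ℕ.* h)
halfEdge h v = tabulate (λ w → ⌊ quotient h w Fin.≟ v ⌋)

power : ∀ {m} (h : ℕ) → Graph m → Hypergraph (m ℕ.* h)
power {m} h G = record { edges = ordinaryEdges ++ loopEdges }
  where
    open Graph G
    ordinaryEdges : List (Subset (m ℕ.* h))
    ordinaryEdges =
      concatMap (λ u → map (λ v → halfEdge h u ∪ halfEdge h v)
                           (List.filter (λ v → u <? v) (List.filter (λ v → adj u v Bool.≟ true) (allFin m))))
                (allFin m)
    loopEdges : List (Subset (m ℕ.* h))
    loopEdges = map (halfEdge h) (List.filter (λ u → loop u Bool.≟ true) (allFin m))

-- Let σ be the transposition of u and ū.  In G^{k,k/2} every edge contains both or neither
-- of u and ū, so σ maps every edge onto itself and u, ū have the same degree d.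
-- Reindexing the sum x_u (A x^{k-1})_u by σ gives s := x_u (A x^{k-1})_u = x_ū (A x^{k-1})_ū:
-- a term a_τ x_{τ_1} ⋯ x_{τ_k} with τ_1 = u is nonzero only when τ lists an edge, in which
-- u and ū each occur exactly once, so σ only permutes its factors.  Multiplying the
-- eigen-equation at v ∈ {u, ū} by x_v gives λ x_v^k + s = d x_v^k; hence
-- (d - λ)(x_u^k - x_ū^k) = 0, and λ ≠ d forces x_u^k = x_ū^k.

module Submission where

open import Defs
open import Data.Nat as ℕ using (ℕ; _≤_)
open import Data.Fin using (Fin; quotient)
open import Relation.Nullary using (¬_)
open import Relation.Binary.PropositionalEquality using (_≡_)

open import Algebra.Properties.AbelianGroup as AbelianGroupProperties using ()
open import Algebra.Properties.CommutativeMonoid.Sum as CommutativeMonoidSum using ()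
open import Algebra.Properties.CommutativeSemigroup as CommutativeSemigroupProperties using ()
open import Algebra.Properties.Group as GroupProperties using ()
open import Algebra.Properties.Ring as RingProperties using ()
open import Algebra.Properties.Semiring.Sum as SemiringSum using ()
open import Data.Bool as Bool using (Bool; true; false; _∧_; _∨_; if_then_else_)
open import Data.Bool.ListAction using (any; all; and; or)
open import Data.Bool.Properties using (T-≡; T-∧)
open import Data.Fin as Fin using (zero; suc; _≟_; punchIn; punchOut)
open import Data.Fin.Permutation as Permutation using (Permutation; _⟨$⟩ʳ_)
open import Data.Fin.Permutation.Components using (transpose)
open import Data.Fin.Properties using (punchIn-punchOut; punchInᵢ≢i)
open import Data.Fin.Subset using (Subset; _∈_; _⊆_; _∪_; ⁅_⁆; ⊥; ∣_∣; inside; outside)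
open import Data.Fin.Subset.Properties
  using (_∈?_; ⊆-antisym; p⊆q⇒∣p∣≤∣q∣; ∣p∣≤∣x∷p∣; ∣⊥∣≡0; ∪-identityˡ; x∈⁅y⁆⇔x≡y; ∪⇔⊎)
open import Data.List as List using (List; filter; length; allFin)
open import Data.List.Membership.Propositional using (find) renaming (_∈_ to _∈ₗ_)
open import Data.List.Membership.Propositional.Properties using (∈-allFin)
open import Data.List.Properties using (map-cong-local; map-tabulate)
open import Data.List.Relation.Unary.All as All using (All; _∷_)
open import Data.List.Relation.Unary.All.Properties using (++⁺; concat⁺; map⁺)
open import Data.List.Relation.Unary.Any as Any using ()
open import Data.List.Relation.Unary.Any.Properties using (any⁺; any⁻)
open import Data.Nat using (zero; suc; s≤s; _≡ᵇ_)
open import Data.Nat.Properties using (≤-trans; ≤-reflexive; <-irrefl; ≡ᵇ⇒≡; module ≤-Reasoning)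
open import Data.Product using (∃; _,_; _×_)
open import Data.Sum using (inj₁; inj₂)
open import Data.Vec using (_∷_; lookup)
open import Data.Vec.Functional as VF using ()
open import Data.Vec.Functional.Properties using (∷-cong)
open import Data.Vec.Properties using (lookup∘tabulate; lookup-zipWith; []=⇒lookup; lookup⇒[]=; ≡-dec)
open import Function using (_∘_; _⇔_; mk⇔; Equivalence)
open import Function.Definitions using (Injective)
open import Relation.Binary.PropositionalEquality using (refl; sym; trans; cong; cong₂; subst; _≢_; _≗_)
open import Relation.Binary.Reasoning.Setoid as SetoidReasoning using ()
open import Relation.Nullary using (Dec; yes; no; ⌊_⌋; contradiction)
open import Relation.Nullary.Decidable using (isYes≗does; does-⇔; dec-true; dec-false; toWitness; fromWitness)
open import Relation.Unary using (Decidable)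

open Equivalence using (to; from)

private
  variable
    k n : ℕ

⌊⌋-true : ∀ {a} {A : Set a} (a? : Dec A) → A → ⌊ a? ⌋ ≡ true
⌊⌋-true a? a = trans (isYes≗does a?) (dec-true a? a)

⌊⌋-false : ∀ {a} {A : Set a} (a? : Dec A) → ¬ A → ⌊ a? ⌋ ≡ false
⌊⌋-false a? ¬a = trans (isYes≗does a?) (dec-false a? ¬a)

⌊⌋-⇔ : ∀ {a b} {A : Set a} {B : Set b} → A ⇔ B → (a? : Dec A) (b? : Dec B) → ⌊ a? ⌋ ≡ ⌊ b? ⌋
⌊⌋-⇔ A⇔B a? b? = trans (isYes≗does a?) (trans (does-⇔ A⇔B a? b?) (sym (isYes≗does b?)))

all-allFin-suc : (P : Fin (suc k) → Bool) → all P (allFin (suc k)) ≡ P zero ∧ all (P ∘ suc) (allFin k)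
all-allFin-suc P =
  cong (λ bs → P zero ∧ and bs) (trans (map-tabulate suc P) (sym (map-tabulate (λ j → j) (P ∘ suc))))

filter-cong-local : ∀ {a p q} {A : Set a} {P : A → Set p} {Q : A → Set q}
                    (P? : Decidable P) (Q? : Decidable Q) {xs : List A} →
                    All (λ x → P x ⇔ Q x) xs → filter P? xs ≡ filter Q? xs
filter-cong-local P? Q? All.[] = refl
filter-cong-local P? Q? {x List.∷ xs} (P⇔Q ∷ P⇔Q-rest) with P? x | Q? x
... | yes _  | yes _  = cong (x List.∷_) (filter-cong-local P? Q? P⇔Q-rest)
... | no _   | no _   = filter-cong-local P? Q? P⇔Q-rest
... | yes px | no ¬qx = contradiction (to P⇔Q px) ¬qx
... | no ¬px | yes qx = contradiction (from P⇔Q qx) ¬px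

-- Transpositions

transpose-matchˡ : (i j : Fin n) → transpose i j i ≡ j
transpose-matchˡ i j rewrite dec-true (i ≟ i) refl = refl

transpose-matchʳ : (i j : Fin n) → transpose i j j ≡ i
transpose-matchʳ i j = go (j ≟ i)
  where
  go : Dec (j ≡ i) → transpose i j j ≡ i
  go (yes j≡i) = subst (λ z → transpose z j j ≡ z) j≡i (transpose-matchˡ j j)
  go (no j≢i) rewrite dec-false (j ≟ i) j≢i | dec-true (j ≟ j) refl = refl

transpose-other : (i j : Fin n) {l : Fin n} → l ≢ i → l ≢ j → transpose i j l ≡ l
transpose-other i j {l} l≢i l≢j rewrite dec-false (l ≟ i) l≢i | dec-false (l ≟ j) l≢j = refl

transpose-involutive : (i j l : Fin n) → transpose i j (transpose i j l) ≡ l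
transpose-involutive i j l = go (l ≟ i) (l ≟ j)
  where
  go : Dec (l ≡ i) → Dec (l ≡ j) → transpose i j (transpose i j l) ≡ l
  go (yes refl) _          = trans (cong (transpose i j) (transpose-matchˡ i j)) (transpose-matchʳ i j)
  go (no _)     (yes refl) = trans (cong (transpose i j) (transpose-matchʳ i j)) (transpose-matchˡ i j)
  go (no l≢i)   (no l≢j)   =
    trans (cong (transpose i j) (transpose-other i j l≢i l≢j)) (transpose-other i j l≢i l≢j)

transpose-closed : (i j : Fin n) {e : Subset n} → (i ∈ e ⇔ j ∈ e) → ∀ {w} → w ∈ e → transpose i j w ∈ e
transpose-closed i j {e} i⇔j {w} w∈e = go (w ≟ i) (w ≟ j)
  where
  go : Dec (w ≡ i) → Dec (w ≡ j) → transpose i j w ∈ e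
  go (yes refl) _          = subst (_∈ e) (sym (transpose-matchˡ i j)) (to i⇔j w∈e)
  go (no _)     (yes refl) = subst (_∈ e) (sym (transpose-matchʳ i j)) (from i⇔j w∈e)
  go (no w≢i)   (no w≢j)   = subst (_∈ e) (sym (transpose-other i j w≢i w≢j)) w∈e

transpose-natural : ∀ {m} {τ : Fin k → Fin m} → Injective _≡_ _≡_ τ →
                    ∀ a b l → τ (transpose a b l) ≡ transpose (τ a) (τ b) (τ l)
transpose-natural {τ = τ} τ-injective a b l = go (l ≟ a) (l ≟ b)
  where
  go : Dec (l ≡ a) → Dec (l ≡ b) → τ (transpose a b l) ≡ transpose (τ a) (τ b) (τ l)
  go (yes refl) _          = trans (cong τ (transpose-matchˡ a b)) (sym (transpose-matchˡ (τ a) (τ b)))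
  go (no _)     (yes refl) = trans (cong τ (transpose-matchʳ a b)) (sym (transpose-matchʳ (τ a) (τ b)))
  go (no l≢a)   (no l≢b)   = trans (cong τ (transpose-other a b l≢a l≢b))
    (sym (transpose-other (τ a) (τ b) (l≢a ∘ τ-injective) (l≢b ∘ τ-injective)))

-- Index tuples and their sets of entries

module _ (τ : Fin k → Fin n) where

  ∈-image⁻ : ∀ {w} → w ∈ image τ → ∃ λ j → τ j ≡ w
  ∈-image⁻ {w} w∈ with Any.satisfied (any⁻ _ (allFin k) (from T-≡ lookup≡true))
    where
    lookup≡true = trans (sym (lookup∘tabulate _ w)) ([]=⇒lookup w∈)
  ... | j , τj≟w = j , toWitness τj≟w

  ∈-image⁺ : ∀ j → τ j ∈ image τ
  ∈-image⁺ j = lookup⇒[]= (τ j) (image τ)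
    (trans (lookup∘tabulate _ (τ j))
           (to T-≡ (any⁺ _ (Any.map (λ { refl → fromWitness refl }) (∈-allFin j)))))

  image-⊆ : ∀ {e} → (∀ j → τ j ∈ e) → image τ ⊆ e
  image-⊆ τ⊆e w∈ with ∈-image⁻ w∈
  ... | j , refl = τ⊆e j

image-cong : {τ τ′ : Fin k → Fin n} → τ ≗ τ′ → image τ ≡ image τ′
image-cong {τ = τ} {τ′} τ≗τ′ = ⊆-antisym
  (image-⊆ τ (λ j → subst (_∈ image τ′) (sym (τ≗τ′ j)) (∈-image⁺ τ′ j)))
  (image-⊆ τ′ (λ j → subst (_∈ image τ) (τ≗τ′ j) (∈-image⁺ τ j)))

image-∘-involution : ∀ {σ : Fin n → Fin n} {e} (τ : Fin k → Fin n) →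
                     (∀ w → σ (σ w) ≡ w) → (∀ {w} → w ∈ e → σ w ∈ e) →
                     image (σ ∘ τ) ≡ e ⇔ image τ ≡ e
image-∘-involution {n = n} {k = k} {σ = σ} {e} τ σ-involutive σ-closed =
  mk⇔ (λ σ∘τ-image → trans (image-cong (λ j → sym (σ-involutive (τ j)))) (image-∘ (σ ∘ τ) σ∘τ-image))
      (image-∘ τ)
  where
  image-∘ : ∀ (τ : Fin k → Fin n) → image τ ≡ e → image (σ ∘ τ) ≡ e
  image-∘ τ refl = ⊆-antisym (image-⊆ (σ ∘ τ) (λ j → σ-closed (∈-image⁺ τ j))) e⊆image
    where
    e⊆image : e ⊆ image (σ ∘ τ)
    e⊆image {w} w∈e with ∈-image⁻ τ (σ-closed w∈e)
    ... | j , τj≡σw =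
      subst (_∈ image (σ ∘ τ)) (trans (cong σ τj≡σw) (σ-involutive w)) (∈-image⁺ (σ ∘ τ) j)

∣⁅x⁆∪p∣≤1+∣p∣ : (x : Fin n) (p : Subset n) → ∣ ⁅ x ⁆ ∪ p ∣ ≤ suc ∣ p ∣
∣⁅x⁆∪p∣≤1+∣p∣ zero    (s ∷ p) rewrite ∪-identityˡ p = s≤s (∣p∣≤∣x∷p∣ s p)
∣⁅x⁆∪p∣≤1+∣p∣ (suc x) (outside ∷ p) = ∣⁅x⁆∪p∣≤1+∣p∣ x p
∣⁅x⁆∪p∣≤1+∣p∣ (suc x) (inside ∷ p)  = s≤s (∣⁅x⁆∪p∣≤1+∣p∣ x p)

∣image∣≤ : (τ : Fin k → Fin n) → ∣ image τ ∣ ≤ k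
∣image∣≤ {zero} {n} τ = ≤-trans (p⊆q⇒∣p∣≤∣q∣ (image-⊆ τ {⊥} λ ())) (≤-reflexive (∣⊥∣≡0 n))
∣image∣≤ {suc k} τ = ≤-trans (p⊆q⇒∣p∣≤∣q∣ (image-⊆ τ entry∈))
  (≤-trans (∣⁅x⁆∪p∣≤1+∣p∣ (τ zero) (image (τ ∘ suc))) (s≤s (∣image∣≤ (τ ∘ suc))))
  where
  entry∈ : ∀ j → τ j ∈ ⁅ τ zero ⁆ ∪ image (τ ∘ suc)
  entry∈ zero    = from ∪⇔⊎ (inj₁ (from x∈⁅y⁆⇔x≡y refl))
  entry∈ (suc j) = from ∪⇔⊎ (inj₂ (∈-image⁺ (τ ∘ suc) j))

-- A repeated entry τ i = τ j can be dropped from τ without changing its set of entries.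
∣image∣≡⇒injective : (τ : Fin k → Fin n) → ∣ image τ ∣ ≡ k → Injective _≡_ _≡_ τ
∣image∣≡⇒injective {suc k} τ ∣image∣≡k {i} {j} τi≡τj with i ≟ j
... | yes i≡j = i≡j
... | no i≢j  = contradiction 1+k≤k (<-irrefl refl)
  where
  τ′ = τ ∘ punchIn i
  entry∈ : ∀ l → τ l ∈ image τ′
  entry∈ l with i ≟ l
  ... | yes refl = subst (_∈ image τ′) (trans (cong τ (punchIn-punchOut i≢j)) (sym τi≡τj))
                         (∈-image⁺ τ′ (punchOut i≢j))
  ... | no i≢l   = subst (_∈ image τ′) (cong τ (punchIn-punchOut i≢l)) (∈-image⁺ τ′ (punchOut i≢l))
  1+k≤k : suc k ≤ k
  1+k≤k = begin
    suc k          ≡⟨ sym ∣image∣≡k ⟩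
    ∣ image τ ∣    ≤⟨ p⊆q⇒∣p∣≤∣q∣ (image-⊆ τ entry∈) ⟩
    ∣ image τ′ ∣   ≤⟨ ∣image∣≤ τ′ ⟩
    k              ∎
    where open ≤-Reasoning

isConstantAt : Fin n → (Fin k → Fin n) → Bool
isConstantAt {k = k} v ι = all (λ j → ⌊ ι j ≟ v ⌋) (allFin k)

isConstantAt-∷-self : (v : Fin n) (ι : Fin k → Fin n) → isConstantAt v (v VF.∷ ι) ≡ isConstantAt v ι
isConstantAt-∷-self v ι =
  trans (all-allFin-suc (λ j → ⌊ (v VF.∷ ι) j ≟ v ⌋)) (cong (_∧ isConstantAt v ι) (⌊⌋-true (v ≟ v) refl))

isConstantAt-∷-other : {v i : Fin n} (ι : Fin k → Fin n) → i ≢ v → isConstantAt v (i VF.∷ ι) ≡ false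
isConstantAt-∷-other {v = v} {i} ι i≢v =
  trans (all-allFin-suc (λ j → ⌊ (i VF.∷ ι) j ≟ v ⌋)) (cong (_∧ isConstantAt v ι) (⌊⌋-false (i ≟ v) i≢v))

-- Hypergraphs

SameEdges : Hypergraph n → Fin n → Fin n → Set
SameEdges H u ū = All (λ e → u ∈ e ⇔ ū ∈ e) (Hypergraph.edges H)

module _ (H : Hypergraph n) where
  open Hypergraph H

  degree-cong : ∀ {u ū} → SameEdges H u ū → degree H u ≡ degree H ū
  degree-cong same = cong length (filter-cong-local (_ ∈?_) (_ ∈?_) same)

  isSizeKEdge-sound : (τ : Fin k → Fin n) → isSizeKEdge k H τ ≡ true →
                      ∃ λ e → e ∈ₗ edges × ∣ e ∣ ≡ k × image τ ≡ e
  isSizeKEdge-sound {k} τ isEdge with find (any⁻ _ edges (from T-≡ isEdge))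
  ... | e , e∈edges , size∧image with to T-∧ size∧image
  ...   | size , image≡e = e , e∈edges , ≡ᵇ⇒≡ ∣ e ∣ k size , toWitness image≡e

  isSizeKEdge⇒injective : (τ : Fin k → Fin n) → isSizeKEdge k H τ ≡ true → Injective _≡_ _≡_ τ
  isSizeKEdge⇒injective τ isEdge with isSizeKEdge-sound τ isEdge
  ... | e , _ , ∣e∣≡k , image≡e = ∣image∣≡⇒injective τ (trans (cong ∣_∣ image≡e) ∣e∣≡k)

  isSizeKEdge-twins : ∀ {u ū} → SameEdges H u ū → (τ : Fin k → Fin n) → isSizeKEdge k H τ ≡ true →
                      u ∈ image τ ⇔ ū ∈ image τ
  isSizeKEdge-twins same τ isEdge with isSizeKEdge-sound τ isEdge
  ... | e , e∈edges , _ , refl = All.lookup same e∈edges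

  isSizeKEdge-cong : {τ τ′ : Fin k → Fin n} → τ ≗ τ′ → isSizeKEdge k H τ ≡ isSizeKEdge k H τ′
  isSizeKEdge-cong {k} τ≗τ′ =
    cong (λ I → any (λ e → (∣ e ∣ ≡ᵇ k) ∧ ⌊ ≡-dec Bool._≟_ I e ⌋) edges) (image-cong τ≗τ′)

  isSizeKEdge-transpose : ∀ {u ū} → SameEdges H u ū → (τ : Fin k → Fin n) →
                          isSizeKEdge k H (transpose u ū ∘ τ) ≡ isSizeKEdge k H τ
  isSizeKEdge-transpose {k} {u} {ū} same τ = cong or (map-cong-local (All.map sameTest same))
    where
    sameTest : ∀ {e} → u ∈ e ⇔ ū ∈ e →
               (∣ e ∣ ≡ᵇ k) ∧ ⌊ ≡-dec Bool._≟_ (image (transpose u ū ∘ τ)) e ⌋ ≡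
               (∣ e ∣ ≡ᵇ k) ∧ ⌊ ≡-dec Bool._≟_ (image τ) e ⌋
    sameTest {e} u⇔ū = cong ((∣ e ∣ ≡ᵇ k) ∧_)
      (⌊⌋-⇔ (image-∘-involution τ (transpose-involutive u ū) (transpose-closed u ū u⇔ū)) _ _)

  -- On an edge, u and ū occur at most once each, so swapping them just permutes the positions.
  isSizeKEdge⇒transpose-permutes : ∀ {u ū} → SameEdges H u ū → (τ : Fin k → Fin n) →
    isSizeKEdge k H τ ≡ true → ∃ λ (ρ : Permutation k k) → ∀ j → transpose u ū (τ j) ≡ τ (ρ ⟨$⟩ʳ j)
  isSizeKEdge⇒transpose-permutes {u = u} {ū} same τ isEdge with u ∈? image τ
  ... | yes u∈ with ∈-image⁻ τ u∈ | ∈-image⁻ τ (to (isSizeKEdge-twins same τ isEdge) u∈)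
  ...   | a , refl | b , refl =
    Permutation.transpose a b , λ j → sym (transpose-natural (isSizeKEdge⇒injective τ isEdge) a b j)
  isSizeKEdge⇒transpose-permutes {u = u} {ū} same τ isEdge | no u∉ =
    Permutation.id , λ j → transpose-other u ū (λ τj≡u → u∉ (entry∈ τj≡u))
                                               (λ τj≡ū → u∉ (from (isSizeKEdge-twins same τ isEdge) (entry∈ τj≡ū)))
    where
    entry∈ : ∀ {j w} → τ j ≡ w → w ∈ image τ
    entry∈ {j} refl = ∈-image⁺ τ j

lookup-≡⇒∈-⇔ : ∀ {u ū : Fin n} (e : Subset n) → lookup e u ≡ lookup e ū → u ∈ e ⇔ ū ∈ e
lookup-≡⇒∈-⇔ {u = u} {ū} e eq =
  mk⇔ (λ u∈ → lookup⇒[]= ū e (trans (sym eq) ([]=⇒lookup u∈)))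
      (λ ū∈ → lookup⇒[]= u e (trans eq ([]=⇒lookup ū∈)))

power-sameEdges : ∀ {m} h (G : Graph m) {u ū : Fin (m ℕ.* h)} → quotient {m} h u ≡ quotient {m} h ū →
                  SameEdges (power h G) u ū
power-sameEdges {m} h G {u} {ū} sameHalfEdge =
  ++⁺ {xs = List.concatMap ordinaryEdgesAt (allFin m)}
      (concat⁺ (map⁺ {f = ordinaryEdgesAt}
        (All.universal (λ a → map⁺ (All.universal (λ b → lookup-≡⇒∈-⇔ _ (∪-lookup a b)) _)) (allFin m))))
      (map⁺ (All.universal (λ a → lookup-≡⇒∈-⇔ _ (halfEdge-lookup a)) _))
  where
  -- The ordinary edges of power h G as in its definition; ++⁺ cannot infer this split of the edge list.
  ordinaryEdgesAt : Fin m → List (Subset (m ℕ.* h))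
  ordinaryEdgesAt a = List.map (λ b → halfEdge h a ∪ halfEdge h b)
    (filter (λ b → a Fin.<? b) (filter (λ b → Graph.adj G a b Bool.≟ true) (allFin m)))
  halfEdge-lookup : ∀ a → lookup (halfEdge h a) u ≡ lookup (halfEdge h a) ū
  halfEdge-lookup a =
    trans (lookup∘tabulate _ u) (trans (cong (λ v → ⌊ v ≟ a ⌋) sameHalfEdge) (sym (lookup∘tabulate _ ū)))
  ∪-lookup : ∀ a b → lookup (halfEdge h a ∪ halfEdge h b) u ≡ lookup (halfEdge h a ∪ halfEdge h b) ū
  ∪-lookup a b = trans (lookup-zipWith _∨_ u (halfEdge h a) (halfEdge h b))
    (trans (cong₂ _∨_ (halfEdge-lookup a) (halfEdge-lookup b))
           (sym (lookup-zipWith _∨_ ū (halfEdge h a) (halfEdge h b))))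

-- Sums, products and tensors over the field

module _ {c ℓ} (F : CharZeroField c ℓ) where
  open TensorDefs F renaming (refl to ≈-refl; sym to ≈-sym; trans to ≈-trans; reflexive to ≈-reflexive)
  open CharZeroField F using (inverse)
  open SemiringSum semiring
    using (sum; sum-cong-≋; ∑-distrib-+; *-distribˡ-sum; sum-permute; sum-remove; sum-replicate-zero)
  private module Product = CommutativeMonoidSum *-commutativeMonoid
  open GroupProperties +-group using (//-rightDividesˡ; x∙y⁻¹≈ε⇒x≈y)
  open AbelianGroupProperties +-abelianGroup using (xyx⁻¹≈y)
  open RingProperties ring using ([y-z]x≈yx-zx)
  open CommutativeSemigroupProperties *-commutativeSemigroup
    using () renaming (x∙yz≈y∙xz to x*yz≈y*xz; xy∙z≈y∙xz to xy*z≈y*xz)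

  sumFin≡sum : ∀ n (f : Fin n → Carrier) → sumFin n f ≡ sum f
  sumFin≡sum zero    f = refl
  sumFin≡sum (suc n) f = cong (f zero +_) (sumFin≡sum n (f ∘ suc))

  prodFin≡product : ∀ n (f : Fin n → Carrier) → prodFin n f ≡ Product.sum f
  prodFin≡product zero    f = refl
  prodFin≡product (suc n) f = cong (f zero *_) (prodFin≡product n (f ∘ suc))

  sumFin-cong : ∀ n {f g : Fin n → Carrier} → (∀ i → f i ≈ g i) → sumFin n f ≈ sumFin n g
  sumFin-cong zero    f≈g = ≈-refl
  sumFin-cong (suc n) f≈g = +-cong (f≈g zero) (sumFin-cong n (f≈g ∘ suc))

  prodFin-cong : ∀ n {f g : Fin n → Carrier} → (∀ i → f i ≈ g i) → prodFin n f ≈ prodFin n g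
  prodFin-cong zero    f≈g = ≈-refl
  prodFin-cong (suc n) f≈g = *-cong (f≈g zero) (prodFin-cong n (f≈g ∘ suc))

  sumFin-+ : ∀ n (f g : Fin n → Carrier) → sumFin n (λ i → f i + g i) ≈ sumFin n f + sumFin n g
  sumFin-+ n f g rewrite sumFin≡sum n f | sumFin≡sum n g | sumFin≡sum n (λ i → f i + g i) =
    ∑-distrib-+ f g

  *-distribˡ-sumFin : ∀ n a (f : Fin n → Carrier) → a * sumFin n f ≈ sumFin n (λ i → a * f i)
  *-distribˡ-sumFin n a f rewrite sumFin≡sum n f | sumFin≡sum n (λ i → a * f i) = *-distribˡ-sum a f

  sumFin-permute : ∀ n (π : Permutation n n) (f : Fin n → Carrier) →
                   sumFin n (λ i → f (π ⟨$⟩ʳ i)) ≈ sumFin n f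
  sumFin-permute n π f rewrite sumFin≡sum n f | sumFin≡sum n (λ i → f (π ⟨$⟩ʳ i)) =
    ≈-sym (sum-permute f π)

  prodFin-permute : ∀ n (π : Permutation n n) (f : Fin n → Carrier) →
                    prodFin n (λ i → f (π ⟨$⟩ʳ i)) ≈ prodFin n f
  prodFin-permute n π f rewrite prodFin≡product n f | prodFin≡product n (λ i → f (π ⟨$⟩ʳ i)) =
    ≈-sym (Product.sum-permute f π)

  sumFin-zero : ∀ n {f : Fin n → Carrier} → (∀ i → f i ≈ 0#) → sumFin n f ≈ 0#
  sumFin-zero n {f} f≈0 rewrite sumFin≡sum n f = ≈-trans (sum-cong-≋ f≈0) (sum-replicate-zero n)

  sumFin-delta : ∀ n (f : Fin n → Carrier) i → (∀ j → j ≢ i → f j ≈ 0#) → sumFin n f ≈ f i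
  sumFin-delta (suc n) f i off rewrite sumFin≡sum (suc n) f = begin
    sum f                             ≈⟨ sum-remove f ⟩
    f i + sum (f ∘ punchIn i)          ≈⟨ +-congˡ (≈-reflexive (sym (sumFin≡sum n (f ∘ punchIn i)))) ⟩
    f i + sumFin n (f ∘ punchIn i)     ≈⟨ +-congˡ (sumFin-zero n (λ j → off (punchIn i j) (punchInᵢ≢i i j))) ⟩
    f i + 0#                          ≈⟨ +-identityʳ (f i) ⟩
    f i                               ∎
    where open SetoidReasoning setoid

  Extensional : ∀ {p n} → ((Fin p → Fin n) → Carrier) → Set ℓ
  Extensional f = ∀ {ι ι′} → ι ≗ ι′ → f ι ≈ f ι′

  module _ {n : ℕ} where

    sumTuples-cong : ∀ p {f g : (Fin p → Fin n) → Carrier} → (∀ ι → f ι ≈ g ι) →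
                     sumTuples p f ≈ sumTuples p g
    sumTuples-cong zero    f≈g = f≈g _
    sumTuples-cong (suc p) f≈g = sumFin-cong n (λ i → sumTuples-cong p (λ ι → f≈g (i VF.∷ ι)))

    sumTuples-+ : ∀ p (f g : (Fin p → Fin n) → Carrier) →
                  sumTuples p (λ ι → f ι + g ι) ≈ sumTuples p f + sumTuples p g
    sumTuples-+ zero    f g = ≈-refl
    sumTuples-+ (suc p) f g = ≈-trans (sumFin-cong n (λ i → sumTuples-+ p _ _)) (sumFin-+ n _ _)

    *-distribˡ-sumTuples : ∀ p a (f : (Fin p → Fin n) → Carrier) →
                           a * sumTuples p f ≈ sumTuples p (λ ι → a * f ι)
    *-distribˡ-sumTuples zero    a f = ≈-refl
    *-distribˡ-sumTuples (suc p) a f =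
      ≈-trans (*-distribˡ-sumFin n a _) (sumFin-cong n (λ i → *-distribˡ-sumTuples p a _))

    sumTuples-zero : ∀ p {f : (Fin p → Fin n) → Carrier} → (∀ ι → f ι ≈ 0#) → sumTuples p f ≈ 0#
    sumTuples-zero zero    f≈0 = f≈0 _
    sumTuples-zero (suc p) f≈0 = sumFin-zero n (λ i → sumTuples-zero p (λ ι → f≈0 (i VF.∷ ι)))

    sumTuples-permute : ∀ p (π : Permutation n n) (f : (Fin p → Fin n) → Carrier) → Extensional f →
                        sumTuples p (λ ι → f (λ j → π ⟨$⟩ʳ ι j)) ≈ sumTuples p f
    sumTuples-permute zero    π f f-ext = f-ext λ ()
    sumTuples-permute (suc p) π f f-ext = begin
      sumFin n (λ i → sumTuples p (λ ι → f (λ j → π ⟨$⟩ʳ (i VF.∷ ι) j)))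
        ≈⟨ sumFin-cong n (λ i → sumTuples-cong p (λ ι → f-ext (∷-cong refl (λ _ → refl)))) ⟩
      sumFin n (λ i → sumTuples p (λ ι → f ((π ⟨$⟩ʳ i) VF.∷ (λ j → π ⟨$⟩ʳ ι j))))
        ≈⟨ sumFin-cong n (λ i → sumTuples-permute p π _ (λ ι≗ι′ → f-ext (∷-cong refl ι≗ι′))) ⟩
      sumFin n (λ i → sumTuples p (λ ι → f ((π ⟨$⟩ʳ i) VF.∷ ι)))
        ≈⟨ sumFin-permute n π (λ i → sumTuples p (λ ι → f (i VF.∷ ι))) ⟩
      sumFin n (λ i → sumTuples p (λ ι → f (i VF.∷ ι)))                                ∎
      where open SetoidReasoning setoid

  module _ {n} (x : Fin n → Carrier) where

    sumTuples-constant : ∀ q v c →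
      sumTuples q (λ ι → (if isConstantAt v ι then c else 0#) * prodFin q (x ∘ ι)) ≈ c * x v ^ q
    sumTuples-constant zero    v c = ≈-refl
    sumTuples-constant (suc q) v c = ≈-trans (sumFin-delta n row v off) on
      where
      open SetoidReasoning setoid
      term : (Fin (suc q) → Fin n) → Carrier
      term ι = (if isConstantAt v ι then c else 0#) * prodFin (suc q) (x ∘ ι)
      row : Fin n → Carrier
      row i = sumTuples q (λ ι → term (i VF.∷ ι))
      off : ∀ i → i ≢ v → row i ≈ 0#
      off i i≢v = sumTuples-zero q λ ι →
        ≈-trans (*-congʳ (≈-reflexive (cong (if_then c else 0#) (isConstantAt-∷-other ι i≢v)))) (zeroˡ _)
      on : row v ≈ c * x v ^ suc q
      on = begin
        sumTuples q (λ ι → term (v VF.∷ ι))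
          ≈⟨ sumTuples-cong q (λ ι → ≈-trans
               (*-congʳ (≈-reflexive (cong (if_then c else 0#) (isConstantAt-∷-self v ι)))) (x*yz≈y*xz _ _ _)) ⟩
        sumTuples q (λ ι → x v * ((if isConstantAt v ι then c else 0#) * prodFin q (x ∘ ι)))
          ≈⟨ *-distribˡ-sumTuples q (x v) _ ⟨
        x v * sumTuples q (λ ι → (if isConstantAt v ι then c else 0#) * prodFin q (x ∘ ι))
          ≈⟨ *-congˡ (sumTuples-constant q v c) ⟩
        x v * (c * x v ^ q)
          ≈⟨ x*yz≈y*xz _ _ _ ⟩
        c * x v ^ suc q ∎

    apply-diagonalTensor : ∀ p (d : Fin n → Carrier) v → apply (diagonalTensor (suc p) d) x v ≈ d v * x v ^ p
    apply-diagonalTensor p d v = ≈-trans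
      (sumTuples-cong p (λ ι → *-congʳ (≈-reflexive (cong (if_then d v else 0#) (isConstantAt-∷-self v ι)))))
      (sumTuples-constant p v (d v))

    module _ (H : Hypergraph n) (p : ℕ) where

      adjacencyMonomial : (Fin (suc p) → Fin n) → Carrier
      adjacencyMonomial τ = adjacencyTensor (suc p) H τ * prodFin (suc p) (x ∘ τ)

      adjacencyMonomial-cong : Extensional adjacencyMonomial
      adjacencyMonomial-cong τ≗τ′ =
        *-cong (≈-reflexive (cong (if_then invFact (suc p) else 0#) (isSizeKEdge-cong H τ≗τ′)))
               (prodFin-cong (suc p) (λ j → ≈-reflexive (cong x (τ≗τ′ j))))

      *-congˡ-onEdges : ∀ τ {a b} → (isSizeKEdge (suc p) H τ ≡ true → a ≈ b) →
                        adjacencyTensor (suc p) H τ * a ≈ adjacencyTensor (suc p) H τ * b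
      *-congˡ-onEdges τ a≈b with isSizeKEdge (suc p) H τ
      ... | true  = *-congˡ (a≈b refl)
      ... | false = ≈-trans (zeroˡ _) (≈-sym (zeroˡ _))

      adjacencyMonomial-transpose : ∀ {u ū} → SameEdges H u ū → ∀ τ →
                                    adjacencyMonomial (transpose u ū ∘ τ) ≈ adjacencyMonomial τ
      adjacencyMonomial-transpose {u} {ū} same τ = ≈-trans
        (*-congʳ (≈-reflexive (cong (if_then invFact (suc p) else 0#) (isSizeKEdge-transpose H same τ))))
        (*-congˡ-onEdges τ permuted)
        where
        permuted : isSizeKEdge (suc p) H τ ≡ true →
                   prodFin (suc p) (x ∘ transpose u ū ∘ τ) ≈ prodFin (suc p) (x ∘ τ)
        permuted isEdge with isSizeKEdge⇒transpose-permutes H same τ isEdge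
        ... | ρ , σ∘τ≡τ∘ρ = ≈-trans (prodFin-cong (suc p) (λ j → ≈-reflexive (cong x (σ∘τ≡τ∘ρ j))))
                                    (prodFin-permute (suc p) ρ (x ∘ τ))

      x*apply-adjacencyTensor : ∀ v → x v * apply (adjacencyTensor (suc p) H) x v ≈
                                      sumTuples p (λ ι → adjacencyMonomial (v VF.∷ ι))
      x*apply-adjacencyTensor v =
        ≈-trans (*-distribˡ-sumTuples p (x v) _) (sumTuples-cong p (λ ι → x*yz≈y*xz _ _ _))

      x*apply-adjacencyTensor-twins : ∀ {u ū} → SameEdges H u ū →
        x u * apply (adjacencyTensor (suc p) H) x u ≈ x ū * apply (adjacencyTensor (suc p) H) x ū
      x*apply-adjacencyTensor-twins {u} {ū} same = begin
        x u * apply (adjacencyTensor (suc p) H) x u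
          ≈⟨ x*apply-adjacencyTensor u ⟩
        sumTuples p (λ ι → adjacencyMonomial (u VF.∷ ι))
          ≈⟨ sumTuples-cong p (λ ι → adjacencyMonomial-transpose same (u VF.∷ ι)) ⟨
        sumTuples p (λ ι → adjacencyMonomial (σ ∘ (u VF.∷ ι)))
          ≈⟨ sumTuples-cong p (λ ι → adjacencyMonomial-cong (∷-cong (transpose-matchˡ u ū) (λ _ → refl))) ⟩
        sumTuples p (λ ι → adjacencyMonomial (ū VF.∷ (σ ∘ ι)))
          ≈⟨ sumTuples-permute p (Permutation.transpose u ū) _
               (λ ι≗ι′ → adjacencyMonomial-cong (∷-cong refl ι≗ι′)) ⟩
        sumTuples p (λ ι → adjacencyMonomial (ū VF.∷ ι))
          ≈⟨ x*apply-adjacencyTensor ū ⟨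
        x ū * apply (adjacencyTensor (suc p) H) x ū ∎
        where
        open SetoidReasoning setoid
        σ = transpose u ū

      apply-laplacianTensor : ∀ v → apply (laplacianTensor (suc p) H) x v + apply (adjacencyTensor (suc p) H) x v ≈
                                    apply (degreeTensor (suc p) H) x v
      apply-laplacianTensor v = ≈-trans (≈-sym (sumTuples-+ p _ _))
        (sumTuples-cong p (λ ι → ≈-trans (≈-sym (distribʳ _ _ _)) (*-congʳ (//-rightDividesˡ _ _))))

      x*eigenequation : ∀ {λ′} → (∀ i → apply (laplacianTensor (suc p) H) x i ≈ λ′ * x i ^ p) → ∀ v →
                        λ′ * x v ^ suc p + x v * apply (adjacencyTensor (suc p) H) x v ≈
                        fromℕ (degree H v) * x v ^ suc p
      x*eigenequation {λ′} eigen v = begin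
        λ′ * (x v * x v ^ p) + x v * A                 ≈⟨ +-congʳ (x*yz≈y*xz _ _ _) ⟩
        x v * (λ′ * x v ^ p) + x v * A                 ≈⟨ +-congʳ (*-congˡ (eigen v)) ⟨
        x v * L + x v * A                              ≈⟨ distribˡ _ _ _ ⟨
        x v * (L + A)                                  ≈⟨ *-congˡ (apply-laplacianTensor v) ⟩
        x v * apply (degreeTensor (suc p) H) x v        ≈⟨ *-congˡ (apply-diagonalTensor p (fromℕ ∘ degree H) v) ⟩
        x v * (fromℕ (degree H v) * x v ^ p)            ≈⟨ x*yz≈y*xz _ _ _ ⟩
        fromℕ (degree H v) * (x v * x v ^ p)            ∎
        where
        open SetoidReasoning setoid
        L = apply (laplacianTensor (suc p) H) x v
        A = apply (adjacencyTensor (suc p) H) x v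

  *-cancelˡ-≉0 : ∀ {a y z} → ¬ a ≈ 0# → a * y ≈ a * z → y ≈ z
  *-cancelˡ-≉0 {a} {y} {z} a≉0 ay≈az with inverse a a≉0
  ... | a⁻¹ , aa⁻¹≈1 = begin
    y                ≈⟨ *-identityˡ y ⟨
    1# * y           ≈⟨ *-congʳ aa⁻¹≈1 ⟨
    (a * a⁻¹) * y    ≈⟨ xy*z≈y*xz a a⁻¹ y ⟩
    a⁻¹ * (a * y)    ≈⟨ *-congˡ ay≈az ⟩
    a⁻¹ * (a * z)    ≈⟨ xy*z≈y*xz a a⁻¹ z ⟨
    (a * a⁻¹) * z    ≈⟨ *-congʳ aa⁻¹≈1 ⟩
    1# * z           ≈⟨ *-identityˡ z ⟩
    z                ∎
    where open SetoidReasoning setoid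

  linear-solution-unique : ∀ {l d s X Y} → ¬ l ≈ d → l * X + s ≈ d * X → l * Y + s ≈ d * Y → X ≈ Y
  linear-solution-unique {l} {d} {s} l≉d X-solves Y-solves =
    *-cancelˡ-≉0 d-l≉0 (≈-trans (solves X-solves) (≈-sym (solves Y-solves)))
    where
    open SetoidReasoning setoid
    d-l≉0 : ¬ d - l ≈ 0#
    d-l≉0 d-l≈0 = l≉d (≈-sym (x∙y⁻¹≈ε⇒x≈y d l d-l≈0))
    solves : ∀ {t} → l * t + s ≈ d * t → (d - l) * t ≈ s
    solves {t} t-solves = begin
      (d - l) * t          ≈⟨ [y-z]x≈yx-zx t d l ⟩
      d * t - l * t        ≈⟨ +-congʳ t-solves ⟨
      l * t + s - l * t    ≈⟨ xyx⁻¹≈y (l * t) s ⟩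
      s                    ∎

  eigenvector-twins : ∀ {n} (H : Hypergraph n) p {u ū : Fin n} → SameEdges H u ū →
                      ∀ {λ′ x} → IsEigenpair (laplacianTensor (suc p) H) λ′ x →
                      ¬ λ′ ≈ fromℕ (degree H u) → x u ^ suc p ≈ x ū ^ suc p
  eigenvector-twins H p {u} {ū} same {λ′} {x} (_ , eigen) λ≉d =
    linear-solution-unique λ≉d (x*eigenequation x H p eigen u) ū-balance
    where
    open SetoidReasoning setoid
    A = apply (adjacencyTensor (suc p) H) x
    ū-balance : λ′ * x ū ^ suc p + x u * A u ≈ fromℕ (degree H u) * x ū ^ suc p
    ū-balance = begin
      λ′ * x ū ^ suc p + x u * A u          ≈⟨ +-congˡ (x*apply-adjacencyTensor-twins x H p same) ⟩
      λ′ * x ū ^ suc p + x ū * A ū          ≈⟨ x*eigenequation x H p eigen ū ⟩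
      fromℕ (degree H ū) * x ū ^ suc p      ≈⟨ *-congʳ (≈-reflexive (cong fromℕ (degree-cong H same))) ⟨
      fromℕ (degree H u) * x ū ^ suc p      ∎

lemma2p1 : ∀ {c ℓ} (F : CharZeroField c ℓ) → let open TensorDefs F in
    (h : ℕ) → 2 ≤ h →
    (m : ℕ) (G : Graph m) →
    (u ū : Fin (m ℕ.* h)) → quotient {m} h u ≡ quotient {m} h ū →
    (λ′ : Carrier) (x : Fin (m ℕ.* h) → Carrier) →
    IsEigenpair (laplacianTensor (2 ℕ.* h) (power h G)) λ′ x →
    ¬ (λ′ ≈ fromℕ (degree (power h G) u)) →
    x u ^ (2 ℕ.* h) ≈ x ū ^ (2 ℕ.* h)
lemma2p1 F (suc h) (s≤s _) m G u ū sameHalfEdge λ′ x eigenpair λ≉d =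
  eigenvector-twins F (power (suc h) G) (ℕ.pred (2 ℕ.* suc h)) (power-sameEdges (suc h) G sameHalfEdge)
                    eigenpair λ≉d
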